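{- Suppose that at the end of phase $h$, $Z^{(h)}[\ell,m]$ is a monochrome block. Then (i) for every $g>h$, $Z^{(g)}[\ell,m]=Z^{(h)}[\ell,m]$; and (ii) the entries of $Z^{(h+1)}$ written during phase $h+1$ while the loop index $k$ ranges over $[\ell,m]$ form a set of monochrome blocks of $Z^{(h+1)}$.
   Context: Strings: $T_0[1,n_0]$, $T_1[1,n_1]$ over a finite ordered alphabet $\Sigma$, with $T_0[n_0]=\$_0$, $T_1[n_1]=\$_1$, where $\$_0<\$_1$ occur nowhere else and are smaller than every other symbol. For a string $T[1,n]$: suffix array $\mathrm{SA}$ (lexicographic order of suffixes, a proper prefix being smaller) and BWT $\mathrm{BWT}[i]=T[\mathrm{SA}[i]-1]$ if $\mathrm{SA}[i]>1$, else $T[n]$. $\mathrm{BWT}_\delta$ is the BWT of $T_\delta$ ($\delta=0,1$). Phases: $Z^{(0)}=0^{n_0}1^{n_1}$; $B[1,n_0+n_1+1]$ initialized with $B[1]=B[n_0+n_1+1]=1$ and other entries $0$. Phase $h\ge1$: set $F[c]=1+$(number of occurrences of symbols smaller than $c$ in $\mathrm{BWT}_0$ and $\mathrm{BWT}_1$), $\mathrm{Bid}[c]=-1$ for all symbols $c$, $k_0=k_1=1$; for $k=1,\dots,n_0+n_1$: if $B[k]\ne0$ and $B[k]\ne h$ set $id\gets k$; $b\gets Z^{(h-1)}[k]$; $c\gets\mathrm{BWT}_b[k_b]$ and increment $k_b$; $j\gets F[c]$ and increment $F[c]$; $Z^{(h)}[j]\gets b$; if $\mathrm{Bid}[c]\ne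 id$ then $\mathrm{Bid}[c]\gets id$ and, if $B[j]=0$, $B[j]\gets h$. At the end of phase $h$, a block is an interval $[\ell,m]$ with $B[\ell]\ne0$, $B[m+1]\ne0$ and $B[\ell+1]=\dots=B[m]=0$; it is monochrome if $Z^{(h)}[\ell,m]$ consists only of $0$'s or only of $1$'s. -}

module Defs where

open import Data.Nat using (ℕ; zero; suc; _+_; _∸_; _≤_; _<_; _<ᵇ_; _≡ᵇ_)
open import Data.Bool using (Bool; true; false; _∧_; _∨_; if_then_else_; not)
open import Data.List using (List; []; _∷_; length; drop; _++_; [_])
open import Data.Maybe using (Maybe; just; nothing)
open import Data.Product using (_×_)
open import Data.Sum using (_⊎_)
open import Relation.Binary.PropositionalEquality using (_≡_; _≢_)

-- Symbols are natural numbers with their usual order.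
-- $₀ is encoded as 0, $₁ as 1; all other symbols are ≥ 2.
-- Arrays are 1-indexed and represented as functions ℕ → _ ; the bit
-- values 0/1 of Z are false/true.

lexLt : List ℕ → List ℕ → Bool
lexLt [] [] = false
lexLt [] (_ ∷ _) = true
lexLt (_ ∷ _) [] = false
lexLt (x ∷ xs) (y ∷ ys) = (x <ᵇ y) ∨ ((x ≡ᵇ y) ∧ lexLt xs ys)

-- 1-indexed access T[i] (default 0 outside [1, length T])
at : List ℕ → ℕ → ℕ
at [] _ = 0
at (x ∷ xs) zero = 0
at (x ∷ xs) (suc zero) = x
at (x ∷ xs) (suc (suc i)) = at xs (suc i)

suffix : List ℕ → ℕ → List ℕ
suffix T i = drop (i ∸ 1) T

countUpTo : (ℕ → Bool) → ℕ → ℕ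
countUpTo p zero = 0
countUpTo p (suc n) = countUpTo p n + (if p (suc n) then 1 else 0)

-- least j ∈ [1, n] with p j (0 if none)
findUpTo : (ℕ → Bool) → ℕ → ℕ
findUpTo p zero = 0
findUpTo p (suc n) =
  let r = findUpTo p n in
  if r ≡ᵇ 0 then (if p (suc n) then suc n else 0) else r

rank : List ℕ → ℕ → ℕ
rank T i = suc (countUpTo (λ j → lexLt (suffix T j) (suffix T i)) (length T))

SA : List ℕ → ℕ → ℕ
SA T r = findUpTo (λ i → rank T i ≡ᵇ r) (length T)

BWT : List ℕ → ℕ → ℕ
BWT T r = if 1 <ᵇ SA T r then at T (SA T r ∸ 1) else at T (length T)

upd : {A : Set} → (ℕ → A) → ℕ → A → (ℕ → A)
upd f i v x = if x ≡ᵇ i then v else f x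

-- Bid[c] is `nothing` for -1; test Bid[c] = id
sameId : Maybe ℕ → ℕ → Bool
sameId nothing _ = false
sameId (just a) b = a ≡ᵇ b

record GState : Set where
  constructor gstate
  field
    Zs : ℕ → Bool
    Bs : ℕ → ℕ

record LState : Set where
  constructor lstate
  field
    F     : ℕ → ℕ
    Bid   : ℕ → Maybe ℕ
    k₀    : ℕ
    k₁    : ℕ
    ident : ℕ
    Zn    : ℕ → Bool
    Bn    : ℕ → ℕ

module Gap (w₀ w₁ : List ℕ) where

  T₀ : List ℕ
  T₀ = w₀ ++ [ 0 ]

  T₁ : List ℕ
  T₁ = w₁ ++ [ 1 ]

  n₀ n₁ N : ℕ
  n₀ = length T₀
  n₁ = length T₁
  N = n₀ + n₁

  bwt : Bool → ℕ → ℕ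
  bwt false = BWT T₀
  bwt true  = BWT T₁

  Finit : ℕ → ℕ
  Finit c = suc (countUpTo (λ r → BWT T₀ r <ᵇ c) n₀ + countUpTo (λ r → BWT T₁ r <ᵇ c) n₁)

  initial : GState
  initial = gstate (λ j → n₀ <ᵇ j) (λ j → if (j ≡ᵇ 1) ∨ (j ≡ᵇ suc N) then 1 else 0)

  loopInit : GState → LState
  loopInit g = lstate Finit (λ _ → nothing) 1 1 0 (λ _ → false) (GState.Bs g)

  stepId : ℕ → LState → ℕ → ℕ
  stepId h s k = if not (LState.Bn s k ≡ᵇ 0) ∧ not (LState.Bn s k ≡ᵇ h) then k else LState.ident s

  stepChar : (ℕ → Bool) → LState → ℕ → ℕ
  stepChar Zold s k = if Zold k then bwt true (LState.k₁ s) else bwt false (LState.k₀ s)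

  stepTarget : (ℕ → Bool) → LState → ℕ → ℕ
  stepTarget Zold s k = LState.F s (stepChar Zold s k)

  step : ℕ → (ℕ → Bool) → LState → ℕ → LState
  step h Zold s k =
    let id' = stepId h s k
        b   = Zold k
        c   = stepChar Zold s k
        j   = stepTarget Zold s k
        k₀' = if b then LState.k₀ s else suc (LState.k₀ s)
        k₁' = if b then suc (LState.k₁ s) else LState.k₁ s
        F'  = upd (LState.F s) c (suc j)
        Zn' = upd (LState.Zn s) j b
    in if sameId (LState.Bid s c) id'
       then lstate F' (LState.Bid s) k₀' k₁' id' Zn' (LState.Bn s)
       else lstate F' (upd (LState.Bid s) c (just id')) k₀' k₁' id' Zn'
                   (if LState.Bn s j ≡ᵇ 0 then upd (LState.Bn s) j h else LState.Bn s)

  run : ℕ → GState → ℕ → LState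
  run h prev zero = loopInit prev
  run h prev (suc k) = step h (GState.Zs prev) (run h prev k) (suc k)

  global : ℕ → GState
  global zero = initial
  global (suc h) = let s = run (suc h) (global h) N in gstate (LState.Zn s) (LState.Bn s)

  Z : ℕ → ℕ → Bool
  Z h = GState.Zs (global h)

  B : ℕ → ℕ → ℕ
  B h = GState.Bs (global h)

  -- position of Z⁽ʰ⁺¹⁾ written in phase h+1 at loop index k ≥ 1
  target : ℕ → ℕ → ℕ
  target h k = stepTarget (Z h) (run (suc h) (global h) (k ∸ 1)) k

  IsBlock : ℕ → ℕ → ℕ → Set
  IsBlock h ℓ m = ℓ ≤ m × B h ℓ ≢ 0 × B h (suc m) ≢ 0
                  × ((i : ℕ) → ℓ < i → i ≤ m → B h i ≡ 0)

  Monochrome : ℕ → ℕ → ℕ → Set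
  Monochrome h ℓ m = ((i : ℕ) → ℓ ≤ i → i ≤ m → Z h i ≡ false)
                   ⊎ ((i : ℕ) → ℓ ≤ i → i ≤ m → Z h i ≡ true)

module Submission where

-- Phase h+1 moves Z⁽ʰ⁾[k] to position LF(k) = F[c] + #(earlier reads of c), where c is the symbol
-- read at k. LF is a permutation of [1, N], and the number of b's of Z⁽ʰ⁺¹⁾ before F[c] + r depends
-- only on the BWTs and on the number of b's of Z⁽ʰ⁾ before the r-th read of c.
-- (i) A mark is only set at the first read of a symbol inside a block, so the counts of 0's and 1's
-- in front of a mark are determined by those in front of an older mark (the block start); by
-- induction on the phase they never change again. A monochrome block lies between two marks, so
-- its counts, hence its entries, are frozen.
-- (ii) The reads of c inside a monochrome block [ℓ, m] land on a contiguous run of positions whose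
-- two ends are marked in phase h+1 (first reads of c in this block and after it, or the start of
-- the next bucket). Hence the block of Z⁽ʰ⁺¹⁾ around any such target lies in the run, consists of
-- targets of [ℓ, m], and inherits their colour.

open import Defs
open import Data.Nat using (ℕ; suc; _≤_; _<_)
open import Data.Bool using (Bool)
open import Data.List using (List)
open import Data.List.Relation.Unary.All using (All)
open import Data.Product using (_×_; Σ)
open import Relation.Binary.PropositionalEquality using (_≡_)

open import Data.Nat using (zero; _+_; _∸_; _⊔_; _≡ᵇ_; _<ᵇ_; _≤′_; ≤′-refl; ≤′-step; z≤n; s≤s)
open import Data.Nat.Properties
open import Data.Bool using (true; false; if_then_else_; _∧_; _∨_; not)
open import Data.Product using (_,_; proj₁; proj₂)
open import Data.Maybe using (just; nothing)
open import Data.Sum using (_⊎_; inj₁; inj₂)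
open import Data.Empty using (⊥-elim)
open import Function using (_∘_; case_of_)
open import Relation.Binary using (tri<; tri≈; tri>)
open import Relation.Binary.PropositionalEquality using (_≢_; refl; sym; trans; cong; cong₂; subst; module ≡-Reasoning)
open import Relation.Nullary using (¬_; Dec; yes; no; does; ¬?)
import Relation.Unary as U
open import Relation.Nullary.Decidable using (dec-true; dec-false; decidable-stable; _×-dec_)
open import Data.Bool.Properties using (if-float; if-eta; ∧-zeroʳ; ∧-identityʳ; ∨-zeroʳ)
import Data.Bool.Properties as Bool
open import Algebra.Properties.CommutativeSemigroup +-commutativeSemigroup using (interchange)

does-true⇒ : ∀ {a} {A : Set a} (a? : Dec A) → does a? ≡ true → A
does-true⇒ (yes a) _ = a

sameId-true : ∀ m n → sameId m n ≡ true → m ≡ just n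
sameId-true (just a) n e = cong just (does-true⇒ (a ≟ n) e)

indicator : Bool → ℕ
indicator b = if b then 1 else 0

module _ (p : ℕ → Bool) where

  countUpTo-suc-true : ∀ n → p (suc n) ≡ true → countUpTo p (suc n) ≡ suc (countUpTo p n)
  countUpTo-suc-true n q rewrite q = +-comm (countUpTo p n) 1

  countUpTo-suc-false : ∀ n → p (suc n) ≡ false → countUpTo p (suc n) ≡ countUpTo p n
  countUpTo-suc-false n q rewrite q = +-identityʳ (countUpTo p n)

  countUpTo-suc-≤ : ∀ n → countUpTo p (suc n) ≤ suc (countUpTo p n)
  countUpTo-suc-≤ n with p (suc n)
  ... | true = ≤-reflexive (+-comm (countUpTo p n) 1)
  ... | false = ≤-trans (≤-reflexive (+-identityʳ _)) (n≤1+n _)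

  countUpTo-mono : ∀ {a n} → a ≤ n → countUpTo p a ≤ countUpTo p n
  countUpTo-mono = go ∘ ≤⇒≤′
    where
    go : ∀ {a n} → a ≤′ n → countUpTo p a ≤ countUpTo p n
    go ≤′-refl = ≤-refl
    go (≤′-step a≤n) = ≤-trans (go a≤n) (m≤m+n _ _)

  countUpTo-≤-∸ : ∀ {a n} → a ≤ n → countUpTo p n ≤ countUpTo p a + (n ∸ a)
  countUpTo-≤-∸ {a} = go ∘ ≤⇒≤′
    where
    go : ∀ {n} → a ≤′ n → countUpTo p n ≤ countUpTo p a + (n ∸ a)
    go ≤′-refl = ≤-reflexive (sym (trans (cong (countUpTo p a +_) (n∸n≡0 a)) (+-identityʳ _)))
    go {suc n} (≤′-step a≤n) = begin
      countUpTo p (suc n)           ≤⟨ countUpTo-suc-≤ n ⟩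
      suc (countUpTo p n)           ≤⟨ s≤s (go a≤n) ⟩
      suc (countUpTo p a + (n ∸ a)) ≡⟨ sym (+-suc _ _) ⟩
      countUpTo p a + suc (n ∸ a)   ≡⟨ cong (countUpTo p a +_) (sym (+-∸-assoc 1 (≤′⇒≤ a≤n))) ⟩
      countUpTo p a + (suc n ∸ a)   ∎
      where open ≤-Reasoning

  countUpTo-≤ : ∀ n → countUpTo p n ≤ n
  countUpTo-≤ n = countUpTo-≤-∸ z≤n

  countUpTo-none : ∀ {a n} → a ≤ n → (∀ i → a < i → i ≤ n → p i ≡ false) → countUpTo p n ≡ countUpTo p a
  countUpTo-none {a} = go ∘ ≤⇒≤′
    where
    go : ∀ {n} → a ≤′ n → (∀ i → a < i → i ≤ n → p i ≡ false) → countUpTo p n ≡ countUpTo p a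
    go ≤′-refl _ = refl
    go {suc n} (≤′-step a≤n) none =
      trans (countUpTo-suc-false n (none (suc n) (s≤s (≤′⇒≤ a≤n)) ≤-refl))
            (go a≤n λ i a<i i≤n → none i a<i (m≤n⇒m≤1+n i≤n))

  countUpTo-all : ∀ {a n} → a ≤ n → (∀ i → a < i → i ≤ n → p i ≡ true) → countUpTo p n ≡ countUpTo p a + (n ∸ a)
  countUpTo-all {a} = go ∘ ≤⇒≤′
    where
    go : ∀ {n} → a ≤′ n → (∀ i → a < i → i ≤ n → p i ≡ true) → countUpTo p n ≡ countUpTo p a + (n ∸ a)
    go ≤′-refl _ = sym (trans (cong (countUpTo p a +_) (n∸n≡0 a)) (+-identityʳ _))
    go {suc n} (≤′-step a≤n) all = begin
      countUpTo p (suc n)           ≡⟨ countUpTo-suc-true n (all (suc n) (s≤s (≤′⇒≤ a≤n)) ≤-refl) ⟩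
      suc (countUpTo p n)           ≡⟨ cong suc (go a≤n λ i a<i i≤n → all i a<i (m≤n⇒m≤1+n i≤n)) ⟩
      suc (countUpTo p a + (n ∸ a)) ≡⟨ sym (+-suc _ _) ⟩
      countUpTo p a + suc (n ∸ a)   ≡⟨ cong (countUpTo p a +_) (sym (+-∸-assoc 1 (≤′⇒≤ a≤n))) ⟩
      countUpTo p a + (suc n ∸ a)   ∎
      where open ≡-Reasoning

  countUpTo-all⁻¹ : ∀ {a n} → a ≤ n → countUpTo p n ≡ countUpTo p a + (n ∸ a) → ∀ i → a < i → i ≤ n → p i ≡ true
  countUpTo-all⁻¹ {a} = go ∘ ≤⇒≤′
    where
    go : ∀ {n} → a ≤′ n → countUpTo p n ≡ countUpTo p a + (n ∸ a) → ∀ i → a < i → i ≤ n → p i ≡ true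
    go ≤′-refl _ i a<i i≤a = ⊥-elim (<⇒≱ a<i i≤a)
    go {suc n} (≤′-step a≤n) full i a<i i≤1+n with p (suc n) in q
    ... | false = ⊥-elim (<⇒≱ (s≤s (countUpTo-≤-∸ (≤′⇒≤ a≤n))) (≤-reflexive full′))
      where
      full′ : suc (countUpTo p a + (n ∸ a)) ≡ countUpTo p n
      full′ = begin
        suc (countUpTo p a + (n ∸ a)) ≡⟨ sym (+-suc _ _) ⟩
        countUpTo p a + suc (n ∸ a)   ≡⟨ cong (countUpTo p a +_) (sym (+-∸-assoc 1 (≤′⇒≤ a≤n))) ⟩
        countUpTo p a + (suc n ∸ a)   ≡⟨ sym full ⟩
        countUpTo p n + 0             ≡⟨ +-identityʳ _ ⟩
        countUpTo p n                 ∎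
        where open ≡-Reasoning
    ... | true with m≤n⇒m<n∨m≡n i≤1+n
    ...   | inj₂ refl = q
    ...   | inj₁ i≤n = go a≤n full′ i a<i (≤-pred i≤n)
      where
      full′ : countUpTo p n ≡ countUpTo p a + (n ∸ a)
      full′ = suc-injective (begin
        suc (countUpTo p n)           ≡⟨ +-comm 1 _ ⟩
        countUpTo p n + 1             ≡⟨ full ⟩
        countUpTo p a + (suc n ∸ a)   ≡⟨ cong (countUpTo p a +_) (+-∸-assoc 1 (≤′⇒≤ a≤n)) ⟩
        countUpTo p a + suc (n ∸ a)   ≡⟨ +-suc _ _ ⟩
        suc (countUpTo p a + (n ∸ a)) ∎)
        where open ≡-Reasoning

  countUpTo-zero⇒false : ∀ {n} → countUpTo p n ≡ 0 → ∀ i → i < n → p (suc i) ≡ false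
  countUpTo-zero⇒false {n} none i i<n with p (suc i) in q
  ... | false = refl
  ... | true = ⊥-elim (1+n≢0 (n≤0⇒n≡0 (begin
      suc (countUpTo p i)   ≡⟨ sym (countUpTo-suc-true i q) ⟩
      countUpTo p (suc i)   ≤⟨ countUpTo-mono i<n ⟩
      countUpTo p n         ≡⟨ none ⟩
      0                     ∎)))
    where open ≤-Reasoning

  countUpTo-hit : ∀ {r} n → r < countUpTo p n → Σ ℕ λ i → i < n × p (suc i) ≡ true × countUpTo p i ≡ r
  countUpTo-hit {r} (suc n) r<count with r <? countUpTo p n
  ... | yes r<count′ with countUpTo-hit n r<count′
  ...   | i , i<n , pi , count-i = i , m≤n⇒m≤1+n i<n , pi , count-i
  countUpTo-hit {r} (suc n) r<count | no r≮count with p (suc n) in q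
  ... | true = n , ≤-refl , q , ≤-antisym (≮⇒≥ r≮count) (≤-pred (subst (r <_) (+-comm _ 1) r<count))
  ... | false = ⊥-elim (r≮count (subst (r <_) (+-identityʳ _) r<count))

countUpTo-≗ : ∀ {p q : ℕ → Bool} → (∀ i → p i ≡ q i) → ∀ n → countUpTo p n ≡ countUpTo q n
countUpTo-≗ p≗q zero = refl
countUpTo-≗ p≗q (suc n) = cong₂ (λ c b → c + indicator b) (countUpTo-≗ p≗q n) (p≗q (suc n))

<ᵇ-suc : ∀ x c → indicator (x <ᵇ suc c) ≡ indicator (x <ᵇ c) + indicator (x ≡ᵇ c)
<ᵇ-suc x c with <-cmp x c
... | tri< x<c x≢c _ rewrite dec-true (x <? suc c) (m≤n⇒m≤1+n x<c) | dec-true (x <? c) x<c | dec-false (x ≟ c) x≢c = refl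
... | tri≈ _ refl _ rewrite dec-true (x <? suc x) ≤-refl | dec-false (x <? x) (n≮n x) | dec-true (x ≟ x) refl = refl
... | tri> _ x≢c c<x
  rewrite dec-false (x <? suc c) (<⇒≱ c<x ∘ ≤-pred) | dec-false (x <? c) (<⇒≱ c<x ∘ <⇒≤) | dec-false (x ≟ c) x≢c = refl

countUpTo-split : ∀ (p q r : ℕ → Bool) → (∀ i → indicator (p i) ≡ indicator (q i) + indicator (r i)) →
  ∀ n → countUpTo p n ≡ countUpTo q n + countUpTo r n
countUpTo-split p q r split zero = refl
countUpTo-split p q r split (suc n) =
  trans (cong₂ _+_ (countUpTo-split p q r split n) (split (suc n)))
        (interchange (countUpTo q n) (countUpTo r n) (indicator (q (suc n))) (indicator (r (suc n))))

module _ {P : ℕ → Set} (P? : U.Decidable P) where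

  private
    none-up-to-suc : ∀ (Q : ℕ → Set) n → ¬ P (suc n) →
      (∀ i → Q i → i ≤ n → ¬ P i) → ∀ i → Q i → i ≤ suc n → ¬ P i
    none-up-to-suc Q n ¬P below i Qi i≤1+n with m≤n⇒m<n∨m≡n i≤1+n
    ... | inj₁ i≤n = below i Qi (≤-pred i≤n)
    ... | inj₂ refl = ¬P

  first-or-none : ∀ a n →
    (∀ i → a ≤ i → i ≤ n → ¬ P i) ⊎ Σ ℕ λ i → a ≤ i × i ≤ n × P i × (∀ j → a ≤ j → j < i → ¬ P j)
  first-or-none a zero with a ≤? 0 | P? 0
  ... | no a≰0 | _ = inj₁ λ i a≤i i≤0 → ⊥-elim (a≰0 (≤-trans a≤i i≤0))
  ... | yes a≤0 | yes P0 = inj₂ (0 , a≤0 , z≤n , P0 , λ j _ j<0 → ⊥-elim (n≮0 j<0))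
  ... | yes _ | no ¬P0 = inj₁ λ { i _ z≤n → ¬P0 }
  first-or-none a (suc n) with first-or-none a n
  ... | inj₂ (i , a≤i , i≤n , Pi , before) = inj₂ (i , a≤i , m≤n⇒m≤1+n i≤n , Pi , before)
  ... | inj₁ none with a ≤? suc n | P? (suc n)
  ...   | no a≰ | _ = inj₁ λ i a≤i i≤1+n → ⊥-elim (a≰ (≤-trans a≤i i≤1+n))
  ...   | yes a≤ | yes P1+n = inj₂ (suc n , a≤ , ≤-refl , P1+n , λ j a≤j j<1+n → none j a≤j (≤-pred j<1+n))
  ...   | yes _ | no ¬P1+n = inj₁ (none-up-to-suc (a ≤_) n ¬P1+n none)

  last-from : ∀ {x} n → P x → x ≤ n → Σ ℕ λ y → x ≤ y × y ≤ n × P y × (∀ i → y < i → i ≤ n → ¬ P i)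
  last-from zero Px z≤n = 0 , z≤n , z≤n , Px , λ i 0<i i≤0 → ⊥-elim (<⇒≱ 0<i i≤0)
  last-from (suc n) Px x≤1+n with P? (suc n)
  ... | yes P1+n = suc n , x≤1+n , ≤-refl , P1+n , λ i n<i i≤n → ⊥-elim (<⇒≱ n<i i≤n)
  ... | no ¬P1+n with m≤n⇒m<n∨m≡n x≤1+n
  ...   | inj₂ refl = ⊥-elim (¬P1+n Px)
  ...   | inj₁ x≤n with last-from n Px (≤-pred x≤n)
  ...     | y , x≤y , y≤n , Py , after = y , x≤y , m≤n⇒m≤1+n y≤n , Py , none-up-to-suc (y <_) n ¬P1+n after

enclosing-block : ∀ (f : ℕ → ℕ) {lo hi t} → f lo ≢ 0 → f hi ≢ 0 → lo ≤ t → t < hi →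
  Σ ℕ λ ℓ → Σ ℕ λ m → (ℓ ≤ m × f ℓ ≢ 0 × f (suc m) ≢ 0 × (∀ i → ℓ < i → i ≤ m → f i ≡ 0))
                    × lo ≤ ℓ × ℓ ≤ t × t ≤ m × suc m ≤ hi
enclosing-block f {lo} {hi} {t} f-lo f-hi lo≤t t<hi
  with last-from (λ x → ¬? (f x ≟ 0)) t f-lo lo≤t | first-or-none (λ x → ¬? (f x ≟ 0)) (suc t) hi
... | _ | inj₁ none = ⊥-elim (none hi t<hi ≤-refl f-hi)
... | ℓ , lo≤ℓ , ℓ≤t , f-ℓ , after | inj₂ (suc m , t<1+m , 1+m≤hi , f-1+m , before) =
  ℓ , m , (≤-trans ℓ≤t (≤-pred t<1+m) , f-ℓ , f-1+m , interior) , lo≤ℓ , ℓ≤t , ≤-pred t<1+m , 1+m≤hi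
  where
  interior : ∀ i → ℓ < i → i ≤ m → f i ≡ 0
  interior i ℓ<i i≤m with i ≤? t
  ... | yes i≤t = decidable-stable (f i ≟ 0) (after i ℓ<i i≤t)
  ... | no i≰t = decidable-stable (f i ≟ 0) (before i (≰⇒> i≰t) (s≤s i≤m))

step-of : ∀ (f : ℕ → ℕ) {x} M → f 0 ≤ x → x < f M → Σ ℕ λ c → f c ≤ x × x < f (suc c)
step-of f zero f0≤x x<f0 = ⊥-elim (<⇒≱ x<f0 f0≤x)
step-of f {x} (suc M) f0≤x x<fM with x <? f M
... | yes x<fM′ = step-of f M f0≤x x<fM′
... | no x≮fM′ = M , ≮⇒≥ x≮fM′ , x<fM

bounded : ∀ (f : ℕ → ℕ) n → Σ ℕ λ b → ∀ r → r ≤ n → f r < b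
bounded f zero = suc (f 0) , λ { .0 z≤n → ≤-refl }
bounded f (suc n) with bounded f n
... | b , below = b ⊔ suc (f (suc n)) , bound
  where
  bound : ∀ r → r ≤ suc n → f r < b ⊔ suc (f (suc n))
  bound r r≤1+n with m≤n⇒m<n∨m≡n r≤1+n
  ... | inj₁ r≤n = ≤-trans (below r (≤-pred r≤n)) (m≤m⊔n b _)
  ... | inj₂ refl = m≤n⊔m b _

module Phases (w₀ w₁ : List ℕ) where
  open Gap w₀ w₁

  -- Opaque, so that unification never unfolds the suffix arrays or the N iterations of a phase.
  opaque
    L : Bool → ℕ → ℕ
    L = bwt

  opaque
    unfolding L
    bwt≡L : ∀ b r → bwt b r ≡ L b r
    bwt≡L b r = refl

  opaque
    loop : ℕ → ℕ → LState
    loop g = run (suc g) (global g)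

  opaque
    unfolding loop
    loop-zero : ∀ g → loop g 0 ≡ loopInit (global g)
    loop-zero g = refl

    loop-suc : ∀ g k → loop g (suc k) ≡ step (suc g) (Z g) (loop g k) (suc k)
    loop-suc g k = refl

    Z-suc : ∀ g x → Z (suc g) x ≡ LState.Zn (loop g N) x
    Z-suc g x = refl

    B-suc : ∀ g x → B (suc g) x ≡ LState.Bn (loop g N) x
    B-suc g x = refl

    target-suc : ∀ h k → target h (suc k) ≡ stepTarget (Z h) (loop h k) (suc k)
    target-suc h k = refl

  module _ (h : ℕ) (z : ℕ → Bool) (s : LState) (k : ℕ) where
    stepSeen : Bool
    stepSeen = sameId (LState.Bid s (stepChar z s k)) (stepId h s k)

    step-k₀ : LState.k₀ (step h z s k) ≡ (if z k then LState.k₀ s else suc (LState.k₀ s))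
    step-k₀ = trans (if-float LState.k₀ stepSeen) (if-eta stepSeen)

    step-k₁ : LState.k₁ (step h z s k) ≡ (if z k then suc (LState.k₁ s) else LState.k₁ s)
    step-k₁ = trans (if-float LState.k₁ stepSeen) (if-eta stepSeen)

    step-F : LState.F (step h z s k) ≡ upd (LState.F s) (stepChar z s k) (suc (stepTarget z s k))
    step-F = trans (if-float LState.F stepSeen) (if-eta stepSeen)

    step-ident : LState.ident (step h z s k) ≡ stepId h s k
    step-ident = trans (if-float LState.ident stepSeen) (if-eta stepSeen)

    step-Zn : LState.Zn (step h z s k) ≡ upd (LState.Zn s) (stepTarget z s k) (z k)
    step-Zn = trans (if-float LState.Zn stepSeen) (if-eta stepSeen)

    step-Bid-char : LState.Bid (step h z s k) (stepChar z s k) ≡ just (stepId h s k)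
    step-Bid-char with stepSeen in q
    ... | true = sameId-true (LState.Bid s (stepChar z s k)) _ q
    ... | false rewrite dec-true (stepChar z s k ≟ stepChar z s k) refl = refl

    step-Bid-other : ∀ c → c ≢ stepChar z s k → LState.Bid (step h z s k) c ≡ LState.Bid s c
    step-Bid-other c c≢ with stepSeen
    ... | true = refl
    ... | false rewrite dec-false (c ≟ stepChar z s k) c≢ = refl

    step-Bn-cases : ∀ x → LState.Bn (step h z s k) x ≡ LState.Bn s x
                        ⊎ (LState.Bn s x ≡ 0 × LState.Bn (step h z s k) x ≡ h × x ≡ stepTarget z s k × stepSeen ≡ false)
    step-Bn-cases x with stepSeen
    ... | true = inj₁ refl
    ... | false with LState.Bn s (stepTarget z s k) ≟ 0
    ...   | no Bn≢0 rewrite dec-false (LState.Bn s (stepTarget z s k) ≟ 0) Bn≢0 = inj₁ refl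
    ...   | yes Bn≡0 rewrite dec-true (LState.Bn s (stepTarget z s k) ≟ 0) Bn≡0 with x ≟ stepTarget z s k
    ...     | no x≢ rewrite dec-false (x ≟ stepTarget z s k) x≢ = inj₁ refl
    ...     | yes refl rewrite dec-true (x ≟ x) refl = inj₂ (Bn≡0 , refl , refl , refl)

    step-Bn-fresh : h ≢ 0 → stepSeen ≡ false → LState.Bn (step h z s k) (stepTarget z s k) ≢ 0
    step-Bn-fresh h≢0 fresh with stepSeen
    step-Bn-fresh h≢0 refl | false with LState.Bn s (stepTarget z s k) ≟ 0
    ... | no Bn≢0 rewrite dec-false (LState.Bn s (stepTarget z s k) ≟ 0) Bn≢0 = Bn≢0
    ... | yes Bn≡0
      rewrite dec-true (LState.Bn s (stepTarget z s k) ≟ 0) Bn≡0 | dec-true (stepTarget z s k ≟ stepTarget z s k) refl = h≢0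

  size : Bool → ℕ
  size false = n₀
  size true  = n₁

  occ : ℕ → Bool → ℕ → ℕ
  occ g b = countUpTo (λ i → does (Z g i Bool.≟ b))

  -- Iteration i of phase g+1 reads the symbol char g i and writes Z⁽ᵍ⁾[i] at position lf g i.
  char : ℕ → ℕ → ℕ
  char g i = L (Z g i) (suc (occ g (Z g i) (i ∸ 1)))

  bwtLess bwtOcc : Bool → ℕ → ℕ → ℕ
  bwtLess b c = countUpTo (λ r → L b r <ᵇ c)
  bwtOcc b c = countUpTo (λ r → L b r ≡ᵇ c)

  C total : ℕ → ℕ
  C c = bwtLess false c n₀ + bwtLess true c n₁
  total c = bwtOcc false c n₀ + bwtOcc true c n₁

  charCount : ℕ → ℕ → ℕ → ℕ
  charCount g c = countUpTo (λ i → char g i ≡ᵇ c)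

  lf : ℕ → ℕ → ℕ
  lf g i = suc (C (char g i) + charCount g (char g i) (i ∸ 1))

  loop-pointers : ∀ g k → LState.k₀ (loop g k) ≡ suc (occ g false k) × LState.k₁ (loop g k) ≡ suc (occ g true k)
  loop-pointers g zero rewrite loop-zero g = refl , refl
  loop-pointers g (suc k)
    rewrite loop-suc g k | step-k₀ (suc g) (Z g) (loop g k) (suc k) | step-k₁ (suc g) (Z g) (loop g k) (suc k)
    with Z g (suc k) | loop-pointers g k
  ... | true  | p₀ , p₁ = trans p₀ (cong suc (sym (+-identityʳ _))) , trans (cong suc p₁) (cong suc (+-comm 1 _))
  ... | false | p₀ , p₁ = trans (cong suc p₀) (cong suc (+-comm 1 _)) , trans p₁ (cong suc (sym (+-identityʳ _)))

  stepChar-loop : ∀ g k → stepChar (Z g) (loop g k) (suc k) ≡ char g (suc k)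
  stepChar-loop g k with Z g (suc k) | loop-pointers g k
  ... | true  | _ , p₁ = trans (cong (bwt true) p₁) (bwt≡L true _)
  ... | false | p₀ , _ = trans (cong (bwt false) p₀) (bwt≡L false _)

  loop-F : ∀ g k c → LState.F (loop g k) c ≡ suc (C c + charCount g c k)
  loop-F g zero c = begin
    LState.F (loop g 0) c ≡⟨ cong (λ s → LState.F s c) (loop-zero g) ⟩
    Finit c               ≡⟨ cong suc (cong₂ _+_ (countUpTo-≗ (λ r → cong (_<ᵇ c) (bwt≡L false r)) n₀)
                                                 (countUpTo-≗ (λ r → cong (_<ᵇ c) (bwt≡L true r)) n₁)) ⟩
    suc (C c)             ≡⟨ cong suc (sym (+-identityʳ _)) ⟩
    suc (C c + 0)         ∎
    where open ≡-Reasoning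
  loop-F g (suc k) c = begin
    LState.F (loop g (suc k)) c
      ≡⟨ cong (λ s → LState.F s c) (loop-suc g k) ⟩
    LState.F (step (suc g) (Z g) (loop g k) (suc k)) c
      ≡⟨ cong (λ f → f c) (step-F (suc g) (Z g) (loop g k) (suc k)) ⟩
    upd F (stepChar (Z g) (loop g k) (suc k)) (suc (F (stepChar (Z g) (loop g k) (suc k)))) c
      ≡⟨ cong (λ d → upd F d (suc (F d)) c) (stepChar-loop g k) ⟩
    upd F (char g (suc k)) (suc (F (char g (suc k)))) c
      ≡⟨ bump c ⟩
    suc (C c + charCount g c (suc k)) ∎
    where
    open ≡-Reasoning
    F : ℕ → ℕ
    F = LState.F (loop g k)
    bump : ∀ c → upd F (char g (suc k)) (suc (F (char g (suc k)))) c ≡ suc (C c + charCount g c (suc k))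
    bump c with c ≟ char g (suc k)
    ... | yes refl rewrite dec-true (c ≟ c) refl =
      cong suc (trans (loop-F g k c) (trans (sym (+-suc _ _)) (cong (C c +_) (+-comm 1 _))))
    ... | no c≢ rewrite dec-false (c ≟ char g (suc k)) c≢ | dec-false (char g (suc k) ≟ c) (c≢ ∘ sym) =
      trans (loop-F g k c) (cong (λ x → suc (C c + x)) (sym (+-identityʳ _)))

  stepTarget-loop : ∀ g k → stepTarget (Z g) (loop g k) (suc k) ≡ lf g (suc k)
  stepTarget-loop g k = trans (cong (LState.F (loop g k)) (stepChar-loop g k)) (loop-F g k (char g (suc k)))

  target≡lf : ∀ h k → target h (suc k) ≡ lf h (suc k)
  target≡lf h k = trans (target-suc h k) (stepTarget-loop h k)

  loop-Zn-suc : ∀ g k x → LState.Zn (loop g (suc k)) x ≡ (if x ≡ᵇ lf g (suc k) then Z g (suc k) else LState.Zn (loop g k) x)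
  loop-Zn-suc g k x = begin
    LState.Zn (loop g (suc k)) x
      ≡⟨ cong (λ s → LState.Zn s x) (loop-suc g k) ⟩
    LState.Zn (step (suc g) (Z g) (loop g k) (suc k)) x
      ≡⟨ cong (λ f → f x) (step-Zn (suc g) (Z g) (loop g k) (suc k)) ⟩
    upd (LState.Zn (loop g k)) (stepTarget (Z g) (loop g k) (suc k)) (Z g (suc k)) x
      ≡⟨ cong (λ j → upd (LState.Zn (loop g k)) j (Z g (suc k)) x) (stepTarget-loop g k) ⟩
    upd (LState.Zn (loop g k)) (lf g (suc k)) (Z g (suc k)) x ∎
    where open ≡-Reasoning

  loop-Zn-last-write : ∀ g k x i → 1 ≤ i → i ≤ k → lf g i ≡ x →
    (∀ i′ → i < i′ → i′ ≤ k → lf g i′ ≢ x) → LState.Zn (loop g k) x ≡ Z g i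
  loop-Zn-last-write g zero x i 1≤i i≤0 _ _ = ⊥-elim (<⇒≱ 1≤i i≤0)
  loop-Zn-last-write g (suc k) x i 1≤i i≤1+k lf-i later rewrite loop-Zn-suc g k x with m≤n⇒m<n∨m≡n i≤1+k
  ... | inj₂ refl rewrite dec-true (x ≟ lf g (suc k)) (sym lf-i) = refl
  ... | inj₁ i≤k rewrite dec-false (x ≟ lf g (suc k)) (later (suc k) i≤k ≤-refl ∘ sym) =
    loop-Zn-last-write g k x i 1≤i (≤-pred i≤k) lf-i (λ i′ i<i′ i′≤k → later i′ i<i′ (m≤n⇒m≤1+n i′≤k))

  C-suc : ∀ c → C (suc c) ≡ C c + total c
  C-suc c = trans (cong₂ _+_ (split false n₀) (split true n₁))
                  (interchange (bwtLess false c n₀) (bwtOcc false c n₀) (bwtLess true c n₁) (bwtOcc true c n₁))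
    where
    split : ∀ b → ∀ n → bwtLess b (suc c) n ≡ bwtLess b c n + bwtOcc b c n
    split b = countUpTo-split _ _ _ (λ r → <ᵇ-suc (L b r) c)

  C-mono : ∀ {c c′} → c ≤ c′ → C c ≤ C c′
  C-mono = go ∘ ≤⇒≤′
    where
    go : ∀ {c c′} → c ≤′ c′ → C c ≤ C c′
    go ≤′-refl = ≤-refl
    go {c′ = suc c′} (≤′-step c≤c′) = ≤-trans (go c≤c′) (≤-trans (m≤m+n _ _) (≤-reflexive (sym (C-suc c′))))

  C-zero : C 0 ≡ 0
  C-zero = cong₂ _+_ (countUpTo-none _ {n = n₀} z≤n (λ _ _ _ → refl)) (countUpTo-none _ {n = n₁} z≤n (λ _ _ _ → refl))

  C-≤-N : ∀ c → C c ≤ N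
  C-≤-N c = +-mono-≤ (countUpTo-≤ _ n₀) (countUpTo-≤ _ n₁)

  top : ℕ
  top = proj₁ (bounded (L false) n₀) ⊔ proj₁ (bounded (L true) n₁)

  bwtLess-top : ∀ b → bwtLess b top (size b) ≡ size b
  bwtLess-top b = countUpTo-all _ z≤n (λ r _ r≤n → dec-true (L b r <? top) (L-<-top b r r≤n))
    where
    L-<-top : ∀ b r → r ≤ size b → L b r < top
    L-<-top false r r≤n = ≤-trans (proj₂ (bounded (L false) n₀) r r≤n) (m≤m⊔n _ _)
    L-<-top true  r r≤n = ≤-trans (proj₂ (bounded (L true) n₁) r r≤n) (m≤n⊔m _ _)

  C-top : C top ≡ N
  C-top = cong₂ _+_ (bwtLess-top false) (bwtLess-top true)

  bitChar : ℕ → Bool → ℕ → ℕ → Bool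
  bitChar g b c i = does (Z g i Bool.≟ b) ∧ (char g i ≡ᵇ c)

  bwtOcc-occ : ∀ g b c s → bwtOcc b c (occ g b s) ≡ countUpTo (bitChar g b c) s
  bwtOcc-occ g b c zero = refl
  bwtOcc-occ g b c (suc s) with Z g (suc s) Bool.≟ b
  ... | yes refl = trans (cong (bwtOcc b c) (+-comm (occ g b s) 1)) (cong (_+ indicator (char g (suc s) ≡ᵇ c)) (bwtOcc-occ g b c s))
  ... | no _ = trans (cong (bwtOcc b c) (+-identityʳ (occ g b s))) (trans (bwtOcc-occ g b c s) (sym (+-identityʳ _)))

  charCount-occ : ∀ g c k → charCount g c k ≡ bwtOcc false c (occ g false k) + bwtOcc true c (occ g true k)
  charCount-occ g c k = trans (countUpTo-split _ _ _ split k) (sym (cong₂ _+_ (bwtOcc-occ g false c k) (bwtOcc-occ g true c k)))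
    where
    split : ∀ i → indicator (char g i ≡ᵇ c) ≡ indicator (bitChar g false c i) + indicator (bitChar g true c i)
    split i with Z g i
    ... | false = sym (+-identityʳ _)
    ... | true = refl

  charCount-self : ∀ g i → charCount g (char g (suc i)) (suc i) ≡ suc (charCount g (char g (suc i)) i)
  charCount-self g i = countUpTo-suc-true _ i (dec-true (char g (suc i) ≟ char g (suc i)) refl)

  C-<-lf : ∀ g i → C (char g i) < lf g i
  C-<-lf g i = s≤s (m≤m+n _ _)

  -- Parametrised by the counts of 0's and 1's in Z⁽ᵍ⁾, so that occ-N below can be proved by induction on g.
  module Phase (g : ℕ) (occ-N : ∀ b → occ g b N ≡ size b) where

    charCount-N : ∀ c → charCount g c N ≡ total c
    charCount-N c = trans (charCount-occ g c N) (cong₂ _+_ (cong (bwtOcc false c) (occ-N false)) (cong (bwtOcc true c) (occ-N true)))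

    lf-≤-C-suc : ∀ i → i < N → lf g (suc i) ≤ C (suc (char g (suc i)))
    lf-≤-C-suc i i<N = begin
      suc (C c + charCount g c i)   ≡⟨ sym (+-suc _ _) ⟩
      C c + suc (charCount g c i)   ≡⟨ cong (C c +_) (sym (charCount-self g i)) ⟩
      C c + charCount g c (suc i)   ≤⟨ +-monoʳ-≤ (C c) (countUpTo-mono _ i<N) ⟩
      C c + charCount g c N         ≡⟨ cong (C c +_) (charCount-N c) ⟩
      C c + total c                 ≡⟨ sym (C-suc c) ⟩
      C (suc c)                     ∎
      where
      open ≤-Reasoning
      c : ℕ
      c = char g (suc i)

    lf-≤-N : ∀ i → i < N → lf g (suc i) ≤ N
    lf-≤-N i i<N = ≤-trans (lf-≤-C-suc i i<N) (C-≤-N (suc (char g (suc i))))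

    lf-<-char : ∀ i i′ → i < N → char g (suc i) < char g (suc i′) → lf g (suc i) < lf g (suc i′)
    lf-<-char i i′ i<N c<c′ = begin-strict
      lf g (suc i)               ≤⟨ lf-≤-C-suc i i<N ⟩
      C (suc (char g (suc i)))   ≤⟨ C-mono c<c′ ⟩
      C (char g (suc i′))        <⟨ C-<-lf g (suc i′) ⟩
      lf g (suc i′)              ∎
      where open ≤-Reasoning

    lf-injective : ∀ i i′ → i < i′ → i′ < N → lf g (suc i) ≢ lf g (suc i′)
    lf-injective i i′ i<i′ i′<N with <-cmp (char g (suc i)) (char g (suc i′))
    ... | tri< c<c′ _ _ = <⇒≢ (lf-<-char i i′ (<-trans i<i′ i′<N) c<c′)
    ... | tri> _ _ c′<c = <⇒≢ (lf-<-char i′ i i′<N c′<c) ∘ sym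
    ... | tri≈ _ c≡c′ _ = λ lf≡ → <⇒≢ count< (+-cancelˡ-≡ (C c) _ _ (suc-injective
            (trans lf≡ (cong (λ d → suc (C d + charCount g d i′)) (sym c≡c′)))))
      where
      c : ℕ
      c = char g (suc i)
      count< : charCount g c i < charCount g c i′
      count< = ≤-trans (≤-reflexive (sym (charCount-self g i))) (countUpTo-mono _ i<i′)

    Z-lf : ∀ i → i < N → Z (suc g) (lf g (suc i)) ≡ Z g (suc i)
    Z-lf i i<N = trans (Z-suc g _) (loop-Zn-last-write g N (lf g (suc i)) (suc i) (s≤s z≤n) i<N refl later)
      where
      later : ∀ i′ → suc i < i′ → i′ ≤ N → lf g i′ ≢ lf g (suc i)
      later (suc i′) (s≤s i<i′) i′<N lf≡ = lf-injective i i′ i<i′ i′<N (sym lf≡)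

    -- The positions C c + 1, …, C c + charCount g c s of Z⁽ᵍ⁺¹⁾ are the images under lf of
    -- the i ≤ s with char g i ≡ c.
    occ-after-C : ∀ b c s → s ≤ N → occ (suc g) b (C c + charCount g c s) ≡ occ (suc g) b (C c) + countUpTo (bitChar g b c) s
    occ-after-C b c zero _ = trans (cong (occ (suc g) b) (+-identityʳ (C c))) (sym (+-identityʳ _))
    occ-after-C b c (suc s) s<N with char g (suc s) ≟ c
    ... | no c≢ = begin
      occ (suc g) b (C c + charCount g c (suc s))
        ≡⟨ cong (λ x → occ (suc g) b (C c + x)) (countUpTo-suc-false _ s (dec-false (char g (suc s) ≟ c) c≢)) ⟩
      occ (suc g) b (C c + charCount g c s)
        ≡⟨ occ-after-C b c s (<⇒≤ s<N) ⟩
      occ (suc g) b (C c) + countUpTo (bitChar g b c) s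
        ≡⟨ cong (occ (suc g) b (C c) +_) (sym (countUpTo-suc-false _ s bit-false)) ⟩
      occ (suc g) b (C c) + countUpTo (bitChar g b c) (suc s) ∎
      where
      open ≡-Reasoning
      bit-false : bitChar g b c (suc s) ≡ false
      bit-false = trans (cong (does (Z g (suc s) Bool.≟ b) ∧_) (dec-false (char g (suc s) ≟ c) c≢)) (∧-zeroʳ _)
    ... | yes refl = begin
      occ (suc g) b (C c + charCount g c (suc s))
        ≡⟨ cong (λ x → occ (suc g) b (C c + x)) (charCount-self g s) ⟩
      occ (suc g) b (C c + suc (charCount g c s))
        ≡⟨ cong (occ (suc g) b) (+-suc (C c) (charCount g c s)) ⟩
      occ (suc g) b (lf g (suc s))
        ≡⟨ cong (λ z → occ (suc g) b (C c + charCount g c s) + indicator (does (z Bool.≟ b))) (Z-lf s s<N) ⟩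
      occ (suc g) b (C c + charCount g c s) + indicator (does (Z g (suc s) Bool.≟ b))
        ≡⟨ cong (_+ indicator (does (Z g (suc s) Bool.≟ b))) (occ-after-C b c s (<⇒≤ s<N)) ⟩
      occ (suc g) b (C c) + countUpTo (bitChar g b c) s + indicator (does (Z g (suc s) Bool.≟ b))
        ≡⟨ +-assoc (occ (suc g) b (C c)) _ _ ⟩
      occ (suc g) b (C c) + (countUpTo (bitChar g b c) s + indicator (does (Z g (suc s) Bool.≟ b)))
        ≡⟨ cong (λ x → occ (suc g) b (C c) + (countUpTo (bitChar g b c) s + indicator x)) (sym bit-self) ⟩
      occ (suc g) b (C c) + countUpTo (bitChar g b c) (suc s) ∎
      where
      open ≡-Reasoning
      bit-self : bitChar g b c (suc s) ≡ does (Z g (suc s) Bool.≟ b)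
      bit-self = trans (cong (does (Z g (suc s) Bool.≟ b) ∧_) (dec-true (c ≟ c) refl)) (∧-identityʳ _)

    occ-C : ∀ b c → occ (suc g) b (C c) ≡ bwtLess b c (size b)
    occ-C b zero = trans (cong (occ (suc g) b) C-zero) (sym (countUpTo-none _ {n = size b} z≤n (λ _ _ _ → refl)))
    occ-C b (suc c) = begin
      occ (suc g) b (C (suc c))
        ≡⟨ cong (occ (suc g) b) (trans (C-suc c) (cong (C c +_) (sym (charCount-N c)))) ⟩
      occ (suc g) b (C c + charCount g c N)
        ≡⟨ occ-after-C b c N ≤-refl ⟩
      occ (suc g) b (C c) + countUpTo (bitChar g b c) N
        ≡⟨ cong₂ _+_ (occ-C b c) (sym (bwtOcc-occ g b c N)) ⟩
      bwtLess b c (size b) + bwtOcc b c (occ g b N)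
        ≡⟨ cong (λ n → bwtLess b c (size b) + bwtOcc b c n) (occ-N b) ⟩
      bwtLess b c (size b) + bwtOcc b c (size b)
        ≡⟨ sym (countUpTo-split _ _ _ (λ r → <ᵇ-suc (L b r) c) (size b)) ⟩
      bwtLess b (suc c) (size b) ∎
      where open ≡-Reasoning

    occ-next : ∀ b c s → s ≤ N →
      occ (suc g) b (C c + charCount g c s) ≡ bwtLess b c (size b) + bwtOcc b c (occ g b s)
    occ-next b c s s≤N = trans (occ-after-C b c s s≤N) (cong₂ _+_ (occ-C b c) (sym (bwtOcc-occ g b c s)))

    occ-N-suc : ∀ b → occ (suc g) b N ≡ size b
    occ-N-suc b = trans (cong (occ (suc g) b) (sym C-top)) (trans (occ-C b top) (bwtLess-top b))

    lf-surjective : ∀ x → x < N → Σ ℕ λ i → i < N × lf g (suc i) ≡ suc x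
    lf-surjective x x<N with step-of C top (≤-trans (≤-reflexive C-zero) z≤n) (subst (x <_) (sym C-top) x<N)
    ... | c , C≤x , x<C′ with countUpTo-hit _ N rank<
      where
      rank< : x ∸ C c < charCount g c N
      rank< = +-cancelˡ-< (C c) _ _ (begin-strict
        C c + (x ∸ C c)  ≡⟨ m+[n∸m]≡n C≤x ⟩
        x                <⟨ x<C′ ⟩
        C (suc c)        ≡⟨ C-suc c ⟩
        C c + total c    ≡⟨ cong (C c +_) (sym (charCount-N c)) ⟩
        C c + charCount g c N ∎)
        where open ≤-Reasoning
    ... | i , i<N , char≡c , rank≡ = i , i<N , (begin
      lf g (suc i)                      ≡⟨ cong (λ d → suc (C d + charCount g d i)) (does-true⇒ (char g (suc i) ≟ c) char≡c) ⟩
      suc (C c + charCount g c i)       ≡⟨ cong (λ r → suc (C c + r)) rank≡ ⟩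
      suc (C c + (x ∸ C c))             ≡⟨ cong suc (m+[n∸m]≡n C≤x) ⟩
      suc x                             ∎)
      where open ≡-Reasoning

  occ-initial : ∀ b → occ 0 b N ≡ size b
  occ-initial false =
    trans (countUpTo-none _ (m≤m+n n₀ n₁) (λ i n₀<i _ → cong (λ z → does (z Bool.≟ false)) (dec-true (n₀ <? i) n₀<i)))
          (countUpTo-all _ z≤n (λ i _ i≤n₀ → cong (λ z → does (z Bool.≟ false)) (dec-false (n₀ <? i) (≤⇒≯ i≤n₀))))
  occ-initial true =
    trans (countUpTo-all _ (m≤m+n n₀ n₁) (λ i n₀<i _ → cong (λ z → does (z Bool.≟ true)) (dec-true (n₀ <? i) n₀<i)))
          (cong₂ _+_ (countUpTo-none _ z≤n
                       (λ i _ i≤n₀ → cong (λ z → does (z Bool.≟ true)) (dec-false (n₀ <? i) (≤⇒≯ i≤n₀))))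
                     (m+n∸m≡n n₀ n₁))

  occ-N : ∀ g b → occ g b N ≡ size b
  occ-N zero = occ-initial
  occ-N (suc g) = Phase.occ-N-suc g (occ-N g)

  module LF (g : ℕ) = Phase g (occ-N g)

  seen : ℕ → ℕ → Bool
  seen g k = sameId (LState.Bid (loop g k) (char g (suc k))) (LState.ident (loop g (suc k)))

  isStart : ℕ → ℕ → Bool
  isStart g v = not (v ≡ᵇ 0) ∧ not (v ≡ᵇ suc g)

  startsBlock : ℕ → ℕ → Bool
  startsBlock g k = isStart g (LState.Bn (loop g k) (suc k))

  ident-loop-suc : ∀ g k → LState.ident (loop g (suc k)) ≡ (if startsBlock g k then suc k else LState.ident (loop g k))
  ident-loop-suc g k = trans (cong LState.ident (loop-suc g k)) (step-ident (suc g) (Z g) (loop g k) (suc k))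

  stepSeen-loop : ∀ g k → stepSeen (suc g) (Z g) (loop g k) (suc k) ≡ seen g k
  stepSeen-loop g k = cong₂ (λ c i → sameId (LState.Bid (loop g k) c) i) (stepChar-loop g k) (sym (ident-loop-suc g k))

  loop-Bn-suc : ∀ g k x → LState.Bn (loop g (suc k)) x ≡ LState.Bn (step (suc g) (Z g) (loop g k) (suc k)) x
  loop-Bn-suc g k x = cong (λ s → LState.Bn s x) (loop-suc g k)

  loop-Bn-cases : ∀ g k x → LState.Bn (loop g (suc k)) x ≡ LState.Bn (loop g k) x
    ⊎ (LState.Bn (loop g k) x ≡ 0 × LState.Bn (loop g (suc k)) x ≡ suc g × x ≡ lf g (suc k) × seen g k ≡ false)
  loop-Bn-cases g k x with step-Bn-cases (suc g) (Z g) (loop g k) (suc k) x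
  ... | inj₁ unchanged = inj₁ (trans (loop-Bn-suc g k x) unchanged)
  ... | inj₂ (was0 , set , x≡ , fresh) =
    inj₂ (was0 , trans (loop-Bn-suc g k x) set , trans x≡ (stepTarget-loop g k) , trans (sym (stepSeen-loop g k)) fresh)

  loop-Bn-fresh : ∀ g k → seen g k ≡ false → LState.Bn (loop g (suc k)) (lf g (suc k)) ≢ 0
  loop-Bn-fresh g k fresh B0 = step-Bn-fresh (suc g) (Z g) (loop g k) (suc k) (λ ()) (trans (stepSeen-loop g k) fresh)
    (trans (sym (loop-Bn-suc g k _)) (subst (λ j → LState.Bn (loop g (suc k)) j ≡ 0) (sym (stepTarget-loop g k)) B0))

  loop-Bn-mono : ∀ g {k k′} x → k ≤ k′ → LState.Bn (loop g k) x ≢ 0 → LState.Bn (loop g k′) x ≢ 0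
  loop-Bn-mono g x = go ∘ ≤⇒≤′
    where
    go : ∀ {k k′} → k ≤′ k′ → LState.Bn (loop g k) x ≢ 0 → LState.Bn (loop g k′) x ≢ 0
    go ≤′-refl marked = marked
    go {k′ = suc k′} (≤′-step k≤k′) marked with loop-Bn-cases g k′ x
    ... | inj₁ unchanged = λ zero → go k≤k′ marked (trans (sym unchanged) zero)
    ... | inj₂ (was0 , _) = ⊥-elim (go k≤k′ marked was0)

  loop-B : ∀ g k x → LState.Bn (loop g k) x ≡ B g x
    ⊎ (B g x ≡ 0 × LState.Bn (loop g k) x ≡ suc g × Σ ℕ λ i → i < k × lf g (suc i) ≡ x × seen g i ≡ false)
  loop-B g zero x = inj₁ (cong (λ s → LState.Bn s x) (loop-zero g))
  loop-B g (suc k) x with loop-Bn-cases g k x | loop-B g k x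
  ... | inj₁ unchanged | inj₁ old = inj₁ (trans unchanged old)
  ... | inj₁ unchanged | inj₂ (B0 , set , i , i<k , lf≡ , fresh) =
    inj₂ (B0 , trans unchanged set , i , m≤n⇒m≤1+n i<k , lf≡ , fresh)
  ... | inj₂ (was0 , set , x≡ , fresh) | inj₁ old = inj₂ (trans (sym old) was0 , set , k , ≤-refl , sym x≡ , fresh)
  ... | inj₂ (was0 , _) | inj₂ (_ , set , _) = ⊥-elim (1+n≢0 (trans (sym set) was0))

  B-suc-cases : ∀ g x → B (suc g) x ≢ 0 → B g x ≢ 0 ⊎ Σ ℕ λ i → i < N × lf g (suc i) ≡ x × seen g i ≡ false
  B-suc-cases g x marked with loop-B g N x
  ... | inj₁ old = inj₁ λ B0 → marked (trans (B-suc g x) (trans old B0))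
  ... | inj₂ (_ , _ , new) = inj₂ new

  B-fresh : ∀ g i → i < N → seen g i ≡ false → B (suc g) (lf g (suc i)) ≢ 0
  B-fresh g i i<N fresh B0 =
    loop-Bn-mono g (lf g (suc i)) i<N (loop-Bn-fresh g i fresh) (trans (sym (B-suc g (lf g (suc i)))) B0)

  B-≤ : ∀ g x → B (suc g) x ≤ suc g
  B-≤ g x with loop-B g N x
  ... | inj₂ (_ , set , _) = ≤-reflexive (trans (B-suc g x) set)
  ... | inj₁ old = ≤-trans (≤-reflexive (trans (B-suc g x) old)) (B-≤′ g)
    where
    B-≤′ : ∀ g → B g x ≤ suc g
    B-≤′ zero with (x ≡ᵇ 1) ∨ (x ≡ᵇ suc N)
    ... | true = ≤-refl
    ... | false = z≤n
    B-≤′ (suc g) = ≤-trans (B-≤ g x) (n≤1+n _)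

  B-initial : ∀ x → B 0 x ≢ 0 → x ≡ 1 ⊎ x ≡ suc N
  B-initial x marked with x ≟ 1 | x ≟ suc N
  ... | yes x≡1 | _ = inj₁ x≡1
  ... | no _ | yes x≡N+1 = inj₂ x≡N+1
  ... | no x≢1 | no x≢N+1 rewrite dec-false (x ≟ 1) x≢1 | dec-false (x ≟ suc N) x≢N+1 = ⊥-elim (marked refl)

  B-end : ∀ g → B g (suc N) ≢ 0
  B-end zero B0 rewrite dec-true (suc N ≟ suc N) refl | ∨-zeroʳ (suc N ≡ᵇ 1) = 1+n≢0 B0
  B-end (suc g) B0 = loop-Bn-mono g (suc N) z≤n
    (λ B0′ → B-end g (trans (sym (cong (λ s → LState.Bn s (suc N)) (loop-zero g))) B0′))
    (trans (sym (B-suc g (suc N))) B0)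

  B-range : ∀ g x → B g x ≢ 0 → 1 ≤ x × x ≤ suc N
  B-range zero x marked with B-initial x marked
  ... | inj₁ refl = s≤s z≤n , s≤s z≤n
  ... | inj₂ refl = s≤s z≤n , ≤-refl
  B-range (suc g) x marked with B-suc-cases g x marked
  ... | inj₁ marked′ = B-range g x marked′
  ... | inj₂ (i , i<N , refl , _) = s≤s z≤n , m≤n⇒m≤1+n (LF.lf-≤-N g i i<N)

  ident-suc-if : ∀ g k {b} → startsBlock g k ≡ b → LState.ident (loop g (suc k)) ≡ (if b then suc k else LState.ident (loop g k))
  ident-suc-if g k refl = ident-loop-suc g k

  startsBlock-marked : ∀ g k → startsBlock g k ≡ true → B g (suc k) ≢ 0
  startsBlock-marked g k starts B0 with loop-B g k (suc k)
  ... | inj₁ old with () ← trans (sym starts) (cong (isStart g) (trans old B0))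
  ... | inj₂ (_ , set , _) with () ← trans (sym starts) (trans (cong (isStart g) set) (cong not (dec-true (g ≟ g) refl)))

  ident-start : ∀ g k → B g (suc k) ≢ 0 → B g (suc k) ≢ suc g → LState.ident (loop g (suc k)) ≡ suc k
  ident-start g k marked ≢g with loop-B g k (suc k)
  ... | inj₂ (B0 , _) = ⊥-elim (marked B0)
  ... | inj₁ old = ident-suc-if g k starts
    where
    starts : startsBlock g k ≡ true
    starts rewrite old | dec-false (B g (suc k) ≟ 0) marked | dec-false (B g (suc k) ≟ suc g) ≢g = refl

  ident-inside : ∀ g k → B g (suc k) ≡ 0 → LState.ident (loop g (suc k)) ≡ LState.ident (loop g k)
  ident-inside g k B0 = ident-suc-if g k inside
    where
    inside : startsBlock g k ≡ false
    inside with loop-B g k (suc k)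
    ... | inj₁ old rewrite old | B0 = refl
    ... | inj₂ (_ , set , _) rewrite set = cong not (dec-true (g ≟ g) refl)

  ident-cases : ∀ g k → (LState.ident (loop g (suc k)) ≡ suc k × B g (suc k) ≢ 0)
                      ⊎ LState.ident (loop g (suc k)) ≡ LState.ident (loop g k)
  ident-cases g k with startsBlock g k in starts
  ... | true = inj₁ (ident-suc-if g k starts , startsBlock-marked g k starts)
  ... | false = inj₂ (ident-suc-if g k starts)

  ident-≤ : ∀ g k → LState.ident (loop g k) ≤ k
  ident-≤ g zero = ≤-reflexive (cong LState.ident (loop-zero g))
  ident-≤ g (suc k) with ident-cases g k
  ... | inj₁ (start , _) = ≤-reflexive start
  ... | inj₂ same = ≤-trans (≤-reflexive same) (m≤n⇒m≤1+n (ident-≤ g k))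

  ident-marked : ∀ g k → LState.ident (loop g k) ≡ 0 ⊎ B g (LState.ident (loop g k)) ≢ 0
  ident-marked g zero = inj₁ (cong LState.ident (loop-zero g))
  ident-marked g (suc k) with ident-cases g k
  ... | inj₁ (start , marked) = inj₂ (subst (λ y → B g y ≢ 0) (sym start) marked)
  ... | inj₂ same rewrite same = ident-marked g k

  ident-mono : ∀ g {k k′} → k ≤ k′ → LState.ident (loop g k) ≤ LState.ident (loop g k′)
  ident-mono g = go ∘ ≤⇒≤′
    where
    go : ∀ {k k′} → k ≤′ k′ → LState.ident (loop g k) ≤ LState.ident (loop g k′)
    go ≤′-refl = ≤-refl
    go {k′ = suc k′} (≤′-step k≤k′) with ident-cases g k′
    ... | inj₁ (start , _) = ≤-trans (go k≤k′) (≤-trans (m≤n⇒m≤1+n (ident-≤ g k′)) (≤-reflexive (sym start)))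
    ... | inj₂ same = ≤-trans (go k≤k′) (≤-reflexive (sym same))

  ident-const : ∀ g {i k} → LState.ident (loop g k) ≤ i → i ≤ k → LState.ident (loop g i) ≡ LState.ident (loop g k)
  ident-const g {i} {k} id≤i i≤k with m≤n⇒m<n∨m≡n i≤k
  ... | inj₂ refl = refl
  ident-const g {i} {suc k} id≤i i≤k | inj₁ i<1+k with ident-cases g k
  ... | inj₁ (start , _) = ⊥-elim (<⇒≱ i<1+k (≤-trans (≤-reflexive (sym start)) id≤i))
  ... | inj₂ same = trans (ident-const g (≤-trans (≤-reflexive (sym same)) id≤i) (≤-pred i<1+k)) (sym same)

  loop-Bid-char : ∀ g k → LState.Bid (loop g (suc k)) (char g (suc k)) ≡ just (LState.ident (loop g (suc k)))
  loop-Bid-char g k = begin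
    LState.Bid (loop g (suc k)) (char g (suc k))
      ≡⟨ cong₂ LState.Bid (loop-suc g k) (sym (stepChar-loop g k)) ⟩
    LState.Bid (step (suc g) (Z g) (loop g k) (suc k)) (stepChar (Z g) (loop g k) (suc k))
      ≡⟨ step-Bid-char (suc g) (Z g) (loop g k) (suc k) ⟩
    just (stepId (suc g) (loop g k) (suc k))
      ≡⟨ cong just (sym (ident-loop-suc g k)) ⟩
    just (LState.ident (loop g (suc k))) ∎
    where open ≡-Reasoning

  loop-Bid-other : ∀ g k c → c ≢ char g (suc k) → LState.Bid (loop g (suc k)) c ≡ LState.Bid (loop g k) c
  loop-Bid-other g k c c≢ = trans (cong (λ s → LState.Bid s c) (loop-suc g k))
    (step-Bid-other (suc g) (Z g) (loop g k) (suc k) c (λ c≡ → c≢ (trans c≡ (stepChar-loop g k))))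

  LastRead : ℕ → ℕ → ℕ → Set
  LastRead g k c = (LState.Bid (loop g k) c ≡ nothing × (∀ i → i < k → char g (suc i) ≢ c))
    ⊎ Σ ℕ λ i → i < k × char g (suc i) ≡ c × LState.Bid (loop g k) c ≡ just (LState.ident (loop g (suc i)))
                × (∀ i′ → i < i′ → i′ < k → char g (suc i′) ≢ c)

  lastRead : ∀ g k c → LastRead g k c
  lastRead g zero c = inj₁ (cong (λ s → LState.Bid s c) (loop-zero g) , λ i ())
  lastRead g (suc k) c with c ≟ char g (suc k)
  ... | yes refl =
    inj₂ (k , ≤-refl , refl , loop-Bid-char g k , λ i′ k<i′ i′<1+k → ⊥-elim (<⇒≱ k<i′ (≤-pred i′<1+k)))
  ... | no c≢ with lastRead g k c
  ...   | inj₁ (none , unread) = inj₁ (trans (loop-Bid-other g k c c≢) none , extend unread)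
    where
    extend : (∀ i → i < k → char g (suc i) ≢ c) → ∀ i → i < suc k → char g (suc i) ≢ c
    extend unread i i<1+k with m≤n⇒m<n∨m≡n (≤-pred i<1+k)
    ... | inj₁ i<k = unread i i<k
    ... | inj₂ refl = c≢ ∘ sym
  ...   | inj₂ (i , i<k , char≡ , last , after) =
    inj₂ (i , m≤n⇒m≤1+n i<k , char≡ , trans (loop-Bid-other g k c c≢) last , extend after)
    where
    extend : (∀ i′ → i < i′ → i′ < k → char g (suc i′) ≢ c) →
             ∀ i′ → i < i′ → i′ < suc k → char g (suc i′) ≢ c
    extend after i′ i<i′ i′<1+k with m≤n⇒m<n∨m≡n (≤-pred i′<1+k)
    ... | inj₁ i′<k = after i′ i<i′ i′<k
    ... | inj₂ refl = c≢ ∘ sym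

  seen-in-block : ∀ g k i → i < k → LState.ident (loop g (suc k)) ≤ suc i →
    LState.Bid (loop g k) (char g (suc k)) ≡ just (LState.ident (loop g (suc i))) → seen g k ≡ true
  seen-in-block g k i i<k id≤ last = begin
    seen g k
      ≡⟨ cong (λ b → sameId b (LState.ident (loop g (suc k)))) last ⟩
    sameId (just (LState.ident (loop g (suc i)))) (LState.ident (loop g (suc k)))
      ≡⟨ cong (λ v → sameId (just v) (LState.ident (loop g (suc k)))) (ident-const g id≤ (s≤s (<⇒≤ i<k))) ⟩
    sameId (just (LState.ident (loop g (suc k)))) (LState.ident (loop g (suc k)))
      ≡⟨ dec-true (LState.ident (loop g (suc k)) ≟ LState.ident (loop g (suc k))) refl ⟩
    true ∎
    where open ≡-Reasoning

  fresh⇒unread-in-block : ∀ g k → seen g k ≡ false →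
    ∀ i → LState.ident (loop g (suc k)) ≤ suc i → i < k → char g (suc i) ≢ char g (suc k)
  fresh⇒unread-in-block g k fresh i id≤ i<k char≡ with lastRead g k (char g (suc k))
  ... | inj₁ (_ , unread) = unread i i<k char≡
  ... | inj₂ (i′ , i′<k , _ , last , after) with i′ <? i
  ...   | yes i′<i = after i i′<i i<k char≡
  ...   | no i′≮i with () ← trans (sym fresh) (seen-in-block g k i′ i′<k (≤-trans id≤ (s≤s (≮⇒≥ i′≮i))) last)

  unread-in-block⇒fresh : ∀ g k →
    (∀ i → i < k → char g (suc i) ≡ char g (suc k) → LState.ident (loop g (suc i)) ≢ LState.ident (loop g (suc k))) →
    seen g k ≡ false
  unread-in-block⇒fresh g k other-block with lastRead g k (char g (suc k))
  ... | inj₁ (none , _) = cong (λ b → sameId b (LState.ident (loop g (suc k)))) none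
  ... | inj₂ (i , i<k , char≡ , last , _) =
    trans (cong (λ b → sameId b (LState.ident (loop g (suc k)))) last)
          (dec-false (LState.ident (loop g (suc i)) ≟ LState.ident (loop g (suc k))) (other-block i i<k char≡))

  colour : ∀ {h ℓ m} → Monochrome h ℓ m → Σ Bool λ b → ∀ i → ℓ ≤ i → i ≤ m → Z h i ≡ b
  colour (inj₁ all-0) = false , all-0
  colour (inj₂ all-1) = true , all-1

  PrefixStable : ℕ → ℕ → Set
  PrefixStable h x = ∀ g → h ≤ g → ∀ b → occ g b x ≡ occ h b x

  -- A mark set in phase g+1 at lf g (suc k) is preceded by C c + charCount g c (ident - 1) entries
  -- (c the symbol read), since c was not read earlier in the block; this depends only on the counts
  -- of 0's and 1's before the block start ident, which are stable by induction.
  marked-prefix-stable : ∀ h p → B h p ≢ 0 → PrefixStable h (p ∸ 1)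
  marked-prefix-stable zero p marked with B-initial p marked
  ... | inj₁ refl = λ _ _ _ → refl
  ... | inj₂ refl = λ g _ b → trans (occ-N g b) (sym (occ-N 0 b))
  marked-prefix-stable (suc g) p marked with B-suc-cases g p marked
  ... | inj₁ marked′ = λ g′ g<g′ b →
    trans (stable g′ (≤-trans (n≤1+n g) g<g′) b) (sym (stable (suc g) (n≤1+n g) b))
    where
    stable : PrefixStable g (p ∸ 1)
    stable = marked-prefix-stable g p marked′
  ... | inj₂ (k , k<N , refl , fresh) = λ { (suc g′) g<g′ b →
      trans (occ-after g′ (≤-pred g<g′) b) (sym (occ-after g ≤-refl b)) }
    where
    c s : ℕ
    c = char g (suc k)
    s = LState.ident (loop g (suc k)) ∸ 1

    s≤k : s ≤ k
    s≤k = ∸-monoˡ-≤ 1 (ident-≤ g (suc k))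

    count-from-s : charCount g c k ≡ charCount g c s
    count-from-s = countUpTo-none _ s≤k λ { (suc i) s<1+i 1+i≤k →
      dec-false (char g (suc i) ≟ c)
        (fresh⇒unread-in-block g k fresh i (≤-trans (m≤n+m∸n _ 1) (s≤s (≤-pred s<1+i))) 1+i≤k) }

    occ-s : ∀ g′ → g ≤ g′ → ∀ b → occ g′ b s ≡ occ g b s
    occ-s g′ g≤g′ b with ident-marked g (suc k)
    ... | inj₁ id≡0 rewrite id≡0 = refl
    ... | inj₂ id-marked = marked-prefix-stable g _ id-marked g′ g≤g′ b

    charCount-s : ∀ g′ → g ≤ g′ → charCount g c s ≡ charCount g′ c s
    charCount-s g′ g≤g′ = trans (charCount-occ g c s)
      (trans (cong₂ (λ u v → bwtOcc false c u + bwtOcc true c v) (sym (occ-s g′ g≤g′ false)) (sym (occ-s g′ g≤g′ true)))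
             (sym (charCount-occ g′ c s)))

    occ-after : ∀ g′ → g ≤ g′ → ∀ b → occ (suc g′) b (lf g (suc k) ∸ 1) ≡ bwtLess b c (size b) + bwtOcc b c (occ g b s)
    occ-after g′ g≤g′ b = begin
      occ (suc g′) b (C c + charCount g c k)
        ≡⟨ cong (λ x → occ (suc g′) b (C c + x)) (trans count-from-s (charCount-s g′ g≤g′)) ⟩
      occ (suc g′) b (C c + charCount g′ c s)
        ≡⟨ LF.occ-next g′ b c s (≤-trans s≤k (<⇒≤ k<N)) ⟩
      bwtLess b c (size b) + bwtOcc b c (occ g′ b s)
        ≡⟨ cong (λ x → bwtLess b c (size b) + bwtOcc b c x) (occ-s g′ g≤g′ b) ⟩
      bwtLess b c (size b) + bwtOcc b c (occ g b s) ∎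
      where open ≡-Reasoning

  monochrome-persists : ∀ h a m b → a ≤ m → PrefixStable h a → PrefixStable h m → (∀ i → a < i → i ≤ m → Z h i ≡ b) →
    ∀ g → h ≤ g → ∀ i → a < i → i ≤ m → Z g i ≡ b
  monochrome-persists h a m b a≤m stable-a stable-m all-b g h≤g i a<i i≤m =
    does-true⇒ (Z g i Bool.≟ b) (countUpTo-all⁻¹ _ a≤m full-g i a<i i≤m)
    where
    full-h : occ h b m ≡ occ h b a + (m ∸ a)
    full-h = countUpTo-all _ a≤m (λ j a<j j≤m → dec-true (Z h j Bool.≟ b) (all-b j a<j j≤m))
    full-g : occ g b m ≡ occ g b a + (m ∸ a)
    full-g = trans (stable-m g h≤g b) (trans full-h (cong (_+ (m ∸ a)) (sym (stable-a g h≤g b))))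

  monochrome-block-persists : ∀ h ℓ m → IsBlock h ℓ m → Monochrome h ℓ m →
    ∀ g → h < g → ∀ i → ℓ ≤ i → i ≤ m → Z g i ≡ Z h i
  monochrome-block-persists h zero m (_ , Bℓ , _) with () ← proj₁ (B-range h 0 Bℓ)
  monochrome-block-persists h (suc a) m (ℓ≤m , Bℓ , Bm , _) mono g h<g i ℓ≤i i≤m with colour {h} mono
  ... | b , all-b = trans (monochrome-persists h a m b (<⇒≤ ℓ≤m) (marked-prefix-stable h (suc a) Bℓ)
                             (marked-prefix-stable h (suc m) Bm) all-b g (<⇒≤ h<g) i ℓ≤i i≤m)
                          (sym (all-b i ℓ≤i i≤m))

  lf-in-bucket : ∀ g a k s → a ≤ k → k < s →
    suc (C (char g (suc k)) + charCount g (char g (suc k)) a) ≤ lf g (suc k)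
    × lf g (suc k) < suc (C (char g (suc k)) + charCount g (char g (suc k)) s)
  lf-in-bucket g a k s a≤k k<s =
      s≤s (+-monoʳ-≤ (C c) (countUpTo-mono _ a≤k))
    , s≤s (+-monoʳ-< (C c) (≤-trans (≤-reflexive (sym (charCount-self g k))) (countUpTo-mono _ k<s)))
    where
    c : ℕ
    c = char g (suc k)

  lf-onto-bucket : ∀ g c a s j → suc (C c + charCount g c a) ≤ j → j < suc (C c + charCount g c s) →
    Σ ℕ λ k → a ≤ k × k < s × lf g (suc k) ≡ j
  lf-onto-bucket g c a s (suc x) lo≤j j<hi = lift (countUpTo-hit _ s rank<)
    where
    C≤x : C c ≤ x
    C≤x = ≤-trans (m≤m+n _ _) (≤-pred lo≤j)

    rank< : x ∸ C c < charCount g c s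
    rank< = +-cancelˡ-< (C c) _ _ (begin-strict
      C c + (x ∸ C c)       ≡⟨ m+[n∸m]≡n C≤x ⟩
      x                     <⟨ ≤-pred j<hi ⟩
      C c + charCount g c s ∎)
      where open ≤-Reasoning

    lift : (Σ ℕ λ k → k < s × (char g (suc k) ≡ᵇ c) ≡ true × charCount g c k ≡ x ∸ C c) →
      Σ ℕ λ k → a ≤ k × k < s × lf g (suc k) ≡ suc x
    lift (k , k<s , char≡c , rank≡) = k , a≤k , k<s , lf≡
      where
      a≤k : a ≤ k
      a≤k with a ≤? k
      ... | yes a≤k = a≤k
      ... | no a≰k = ⊥-elim (<⇒≱ count< (countUpTo-mono _ (≰⇒> a≰k)))
        where
        open ≤-Reasoning
        count< : charCount g c a < charCount g c (suc k)
        count< = begin-strict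
          charCount g c a         ≤⟨ +-cancelˡ-≤ (C c) _ _ (≤-trans (≤-pred lo≤j) (≤-reflexive (sym (m+[n∸m]≡n C≤x)))) ⟩
          x ∸ C c                 ≡⟨ sym rank≡ ⟩
          charCount g c k         <⟨ n<1+n _ ⟩
          suc (charCount g c k)   ≡⟨ sym (countUpTo-suc-true _ k char≡c) ⟩
          charCount g c (suc k)   ∎
      lf≡ : lf g (suc k) ≡ suc x
      lf≡ = begin
        lf g (suc k)                   ≡⟨ cong (λ d → suc (C d + charCount g d k)) (does-true⇒ (char g (suc k) ≟ c) char≡c) ⟩
        suc (C c + charCount g c k)    ≡⟨ cong (λ r → suc (C c + r)) rank≡ ⟩
        suc (C c + (x ∸ C c))          ≡⟨ cong suc (m+[n∸m]≡n C≤x) ⟩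
        suc x                          ∎
        where open ≡-Reasoning

  fresh-if-reads-before : ∀ g k d → d ≤ LState.ident (loop g (suc k)) →
    (∀ i → i < k → char g (suc i) ≡ char g (suc k) → suc i < d) → seen g k ≡ false
  fresh-if-reads-before g k d d≤id earlier = unread-in-block⇒fresh g k λ i i<k same id≡ →
    <⇒≱ (earlier i i<k same) (≤-trans d≤id (≤-trans (≤-reflexive (sym id≡)) (ident-≤ g (suc i))))

  B-bucket-start : ∀ g c → B (suc g) (suc (C c)) ≢ 0
  B-bucket-start g c = by-cases (C c <? N)
    where
    by-cases : Dec (C c < N) → B (suc g) (suc (C c)) ≢ 0
    by-cases (no C≮N) = subst (λ x → B (suc g) (suc x) ≢ 0) (sym (≤-antisym (C-≤-N c) (≮⇒≥ C≮N))) (B-end (suc g))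
    by-cases (yes C<N) = image (LF.lf-surjective g (C c) C<N)
      where
      image : (Σ ℕ λ i → i < N × lf g (suc i) ≡ suc (C c)) → B (suc g) (suc (C c)) ≢ 0
      image (i , i<N , lf≡) = subst (λ x → B (suc g) x ≢ 0) lf≡ (B-fresh g i i<N fresh)
        where
        c′ : ℕ
        c′ = char g (suc i)
        c≤c′ : c ≤ c′
        c≤c′ with c ≤? c′
        ... | yes c≤c′ = c≤c′
        ... | no c≰c′ = ⊥-elim (1+n≰n (subst (_≤ C c) lf≡ (≤-trans (LF.lf-≤-C-suc g i i<N) (C-mono (≰⇒> c≰c′)))))
        first : charCount g c′ i ≡ 0
        first = n≤0⇒n≡0 (+-cancelˡ-≤ (C c′) _ _ (begin
          C c′ + charCount g c′ i  ≡⟨ suc-injective lf≡ ⟩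
          C c                      ≤⟨ C-mono c≤c′ ⟩
          C c′                     ≡⟨ sym (+-identityʳ _) ⟩
          C c′ + 0                 ∎))
          where open ≤-Reasoning
        fresh : seen g i ≡ false
        fresh = unread-in-block⇒fresh g i λ i′ i′<i same _ →
          case trans (sym (dec-true (char g (suc i′) ≟ c′) same)) (countUpTo-zero⇒false _ first i′ i′<i) of λ ()

  -- The id update skips marks equal to the running phase. From phase 2 on, inherited marks are
  -- smaller; in phase 1 the initial marks B[1] = B[N+1] = 1 are not, which is why h ≥ 1 is assumed.
  B-below-next-phase : ∀ g x → B (suc g) x ≢ suc (suc g)
  B-below-next-phase g x B≡ = <⇒≱ (s≤s (B-≤ g x)) (≤-reflexive (sym B≡))

  monochrome-of : ∀ {h ℓ m} b → (∀ i → ℓ ≤ i → i ≤ m → Z h i ≡ b) → Monochrome h ℓ m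
  monochrome-of false all-0 = inj₁ all-0
  monochrome-of true  all-1 = inj₂ all-1

  ImageBlock : ℕ → ℕ → ℕ → ℕ → Set
  ImageBlock h ℓ m k = Σ ℕ λ ℓ′ → Σ ℕ λ m′ → IsBlock (suc h) ℓ′ m′
    × ℓ′ ≤ target h k × target h k ≤ m′
    × (∀ j → ℓ′ ≤ j → j ≤ m′ → Σ ℕ λ k′ → ℓ ≤ k′ × k′ ≤ m × target h k′ ≡ j)
    × Monochrome (suc h) ℓ′ m′

  module BlockImage (h₀ a m : ℕ) (block : IsBlock (suc h₀) (suc a) m)
                    (b : Bool) (all-b : ∀ i → suc a ≤ i → i ≤ m → Z (suc h₀) i ≡ b) where

    private
      h : ℕ
      h = suc h₀

      B-m : B h (suc m) ≢ 0
      B-m = proj₁ (proj₂ (proj₂ block))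

    m≤N : m ≤ N
    m≤N = ≤-pred (proj₂ (B-range h (suc m) B-m))

    ident-in-block : ∀ i → suc a ≤ i → i ≤ m → LState.ident (loop h i) ≡ suc a
    ident-in-block (suc i) a<1+i 1+i≤m with m≤n⇒m<n∨m≡n a<1+i
    ... | inj₂ refl = ident-start h i (proj₁ (proj₂ block)) (B-below-next-phase h₀ (suc i))
    ... | inj₁ a<i = trans (ident-inside h i (proj₂ (proj₂ (proj₂ block)) (suc i) a<i 1+i≤m))
                           (ident-in-block i (≤-pred a<i) (≤-trans (n≤1+n i) 1+i≤m))

    ident-after-block : LState.ident (loop h (suc m)) ≡ suc m
    ident-after-block = ident-start h m B-m (B-below-next-phase h₀ (suc m))

    module _ (k : ℕ) (a≤k : a ≤ k) (k<m : k < m) where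

      private
        c : ℕ
        c = char h (suc k)

      bucket-lo-marked : B (suc h) (suc (C c + charCount h c a)) ≢ 0
      bucket-lo-marked = from-first (first-or-none (λ i → char h (suc i) ≟ c) a k)
        where
        from-first : (∀ i → a ≤ i → i ≤ k → char h (suc i) ≢ c)
                     ⊎ (Σ ℕ λ i → a ≤ i × i ≤ k × char h (suc i) ≡ c × (∀ j → a ≤ j → j < i → char h (suc j) ≢ c)) →
                     B (suc h) (suc (C c + charCount h c a)) ≢ 0
        from-first (inj₁ none) = ⊥-elim (none k a≤k ≤-refl refl)
        from-first (inj₂ (i , a≤i , i≤k , char≡ , before)) = subst (λ x → B (suc h) x ≢ 0) lf≡ (B-fresh h i i<N fresh)
          where
          i<N : i < N
          i<N = ≤-trans (s≤s i≤k) (≤-trans k<m m≤N)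
          lf≡ : lf h (suc i) ≡ suc (C c + charCount h c a)
          lf≡ = trans (cong (λ d → suc (C d + charCount h d i)) char≡)
                      (cong (λ x → suc (C c + x)) (countUpTo-none _ a≤i λ { (suc j) a<1+j 1+j≤i →
                         dec-false (char h (suc j) ≟ c) (before j (≤-pred a<1+j) 1+j≤i) }))
          fresh : seen h i ≡ false
          fresh = fresh-if-reads-before h i (suc a)
            (≤-reflexive (sym (ident-in-block (suc i) (s≤s a≤i) (≤-trans (s≤s i≤k) k<m))))
            λ j j<i same → case a ≤? j of λ
              { (yes a≤j) → ⊥-elim (before j a≤j j<i (trans same char≡))
              ; (no a≰j) → s≤s (≰⇒> a≰j) }

      bucket-hi-marked : B (suc h) (suc (C c + charCount h c m)) ≢ 0
      bucket-hi-marked = from-first (first-or-none (λ i → (i <? N) ×-dec (char h (suc i) ≟ c)) m N)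
        where
        from-first : (∀ i → m ≤ i → i ≤ N → ¬ (i < N × char h (suc i) ≡ c))
                     ⊎ (Σ ℕ λ i → m ≤ i × i ≤ N × (i < N × char h (suc i) ≡ c)
                                  × (∀ j → m ≤ j → j < i → ¬ (j < N × char h (suc j) ≡ c))) →
                     B (suc h) (suc (C c + charCount h c m)) ≢ 0
        from-first (inj₁ none) = subst (λ x → B (suc h) (suc x) ≢ 0) (sym hi≡) (B-bucket-start h (suc c))
          where
          unread : charCount h c N ≡ charCount h c m
          unread = countUpTo-none _ m≤N λ { (suc j) m<1+j 1+j≤N →
            dec-false (char h (suc j) ≟ c) (λ same → none j (≤-pred m<1+j) (<⇒≤ 1+j≤N) (1+j≤N , same)) }
          hi≡ : C c + charCount h c m ≡ C (suc c)
          hi≡ = begin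
            C c + charCount h c m   ≡⟨ cong (C c +_) (sym unread) ⟩
            C c + charCount h c N   ≡⟨ cong (C c +_) (LF.charCount-N h c) ⟩
            C c + total c           ≡⟨ sym (C-suc c) ⟩
            C (suc c)               ∎
            where open ≡-Reasoning
        from-first (inj₂ (i , m≤i , _ , (i<N , char≡) , before)) = subst (λ x → B (suc h) x ≢ 0) lf≡ (B-fresh h i i<N fresh)
          where
          lf≡ : lf h (suc i) ≡ suc (C c + charCount h c m)
          lf≡ = trans (cong (λ d → suc (C d + charCount h d i)) char≡)
                      (cong (λ x → suc (C c + x)) (countUpTo-none _ m≤i λ { (suc j) m<1+j 1+j≤i →
                         dec-false (char h (suc j) ≟ c) (λ same → before j (≤-pred m<1+j) 1+j≤i (<-trans 1+j≤i i<N , same)) }))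
          fresh : seen h i ≡ false
          fresh = fresh-if-reads-before h i (suc m)
            (≤-trans (≤-reflexive (sym ident-after-block)) (ident-mono h (s≤s m≤i)))
            λ j j<i same → case m ≤? j of λ
              { (yes m≤j) → ⊥-elim (before j m≤j j<i (<-trans j<i i<N , trans same char≡))
              ; (no m≰j) → s≤s (≰⇒> m≰j) }

      block-image : ImageBlock h (suc a) m (suc k)
      block-image = from-enclosing (enclosing-block (B (suc h)) bucket-lo-marked bucket-hi-marked lo≤t t<hi)
        where
        lo≤t : suc (C c + charCount h c a) ≤ lf h (suc k)
        lo≤t = proj₁ (lf-in-bucket h a k m a≤k k<m)
        t<hi : lf h (suc k) < suc (C c + charCount h c m)
        t<hi = proj₂ (lf-in-bucket h a k m a≤k k<m)

        from-enclosing : (Σ ℕ λ ℓ′ → Σ ℕ λ m′ → IsBlock (suc h) ℓ′ m′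
                            × suc (C c + charCount h c a) ≤ ℓ′ × ℓ′ ≤ lf h (suc k) × lf h (suc k) ≤ m′
                            × suc m′ ≤ suc (C c + charCount h c m)) → ImageBlock h (suc a) m (suc k)
        from-enclosing (ℓ′ , m′ , block′ , lo≤ℓ′ , ℓ′≤t , t≤m′ , m′<hi) =
          ℓ′ , m′ , block′ ,
          subst (ℓ′ ≤_) (sym (target≡lf h k)) ℓ′≤t , subst (_≤ m′) (sym (target≡lf h k)) t≤m′ ,
          covered , monochrome-of {suc h} b λ j ℓ′≤j j≤m′ → colour-of (preimage j ℓ′≤j j≤m′)
          where
          preimage : ∀ j → ℓ′ ≤ j → j ≤ m′ → Σ ℕ λ k′ → a ≤ k′ × k′ < m × lf h (suc k′) ≡ j
          preimage j ℓ′≤j j≤m′ = lf-onto-bucket h c a m j (≤-trans lo≤ℓ′ ℓ′≤j) (≤-trans (s≤s j≤m′) m′<hi)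

          covered : ∀ j → ℓ′ ≤ j → j ≤ m′ → Σ ℕ λ k′ → suc a ≤ k′ × k′ ≤ m × target h k′ ≡ j
          covered j ℓ′≤j j≤m′ with preimage j ℓ′≤j j≤m′
          ... | k′ , a≤k′ , k′<m , lf≡ = suc k′ , s≤s a≤k′ , k′<m , trans (target≡lf h k′) lf≡

          colour-of : ∀ {j} → (Σ ℕ λ k′ → a ≤ k′ × k′ < m × lf h (suc k′) ≡ j) → Z (suc h) j ≡ b
          colour-of (k′ , a≤k′ , k′<m , refl) =
            trans (LF.Z-lf h k′ (≤-trans k′<m m≤N)) (all-b (suc k′) (s≤s a≤k′) k′<m)

  monochrome-block-image : ∀ h ℓ m → 1 ≤ h → IsBlock h ℓ m → Monochrome h ℓ m →
    ∀ k → ℓ ≤ k → k ≤ m → ImageBlock h ℓ m k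
  monochrome-block-image (suc h₀) (suc a) m _ block mono (suc k) ℓ≤k k≤m =
    BlockImage.block-image h₀ a m block (proj₁ (colour {suc h₀} mono)) (proj₂ (colour {suc h₀} mono)) k (≤-pred ℓ≤k) k≤m
  monochrome-block-image (suc h₀) zero m _ (_ , B-ℓ , _) =
    ⊥-elim (case proj₁ (B-range (suc h₀) 0 B-ℓ) of λ ())

lemma4 : (w₀ w₁ : List ℕ) → All (2 ≤_) w₀ → All (2 ≤_) w₁ →
    (h ℓ m : ℕ) → 1 ≤ h →
    Gap.IsBlock w₀ w₁ h ℓ m → Gap.Monochrome w₀ w₁ h ℓ m →
    ((g : ℕ) → h < g → (i : ℕ) → ℓ ≤ i → i ≤ m → Gap.Z w₀ w₁ g i ≡ Gap.Z w₀ w₁ h i)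
    × ((k : ℕ) → ℓ ≤ k → k ≤ m →
        Σ ℕ λ ℓ′ → Σ ℕ λ m′ →
          Gap.IsBlock w₀ w₁ (suc h) ℓ′ m′
          × ℓ′ ≤ Gap.target w₀ w₁ h k × Gap.target w₀ w₁ h k ≤ m′
          × ((j : ℕ) → ℓ′ ≤ j → j ≤ m′ →
              Σ ℕ λ k′ → ℓ ≤ k′ × k′ ≤ m × Gap.target w₀ w₁ h k′ ≡ j)
          × Gap.Monochrome w₀ w₁ (suc h) ℓ′ m′)
lemma4 w₀ w₁ _ _ h ℓ m 1≤h block mono =
  monochrome-block-persists h ℓ m block mono , monochrome-block-image h ℓ m 1≤h block mono
  where open Phases w₀ w₁
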